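{- Let $\mathfrak{G}$ be a permutation group acting on a finite set $V$ and let $v',v''\in V$. Let $\mathcal{B}(v',v'')$ be the bipartite graph whose vertex set is the disjoint union of the set of orbits of $\mathfrak{G}_{v'}$ on $V$ and the set of orbits of $\mathfrak{G}_{v''}$ on $V$, an orbit $O'$ of $\mathfrak{G}_{v'}$ being adjacent to an orbit $O''$ of $\mathfrak{G}_{v''}$ iff $O'\cap O''\neq\emptyset$. Let $C[v']\subseteq V$ be the union of the orbits belonging to the connected component of $\mathcal{B}(v',v'')$ that contains the orbit of $\mathfrak{G}_{v'}$ containing $v'$. Then $C[v']$ is a block for $\mathfrak{G}$.
   Context: $\mathfrak{G}_v=\{\sigma\in\mathfrak{G}:\sigma v=v\}$. A block is a nonempty subset $B$ of an orbit of $\mathfrak{G}$ with $\sigma B=B$ or $\sigma B\cap B=\emptyset$ for all $\sigma\in\mathfrak{G}$. -}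

module Defs where

open import Data.Nat using (ℕ)
open import Data.Fin using (Fin)
open import Data.Fin.Permutation using (Permutation′; _⟨$⟩ʳ_; _⟨$⟩ˡ_)
open import Data.List using (List)
open import Data.List.Relation.Unary.Any using (Any)
open import Data.Product using (Σ; ∃; _×_; _,_)
open import Data.Sum using (_⊎_)
open import Data.Bool using (Bool; true; false)
open import Relation.Binary.PropositionalEquality using (_≡_)
open import Relation.Binary.Construct.Closure.ReflexiveTransitive using (Star)
open import Relation.Nullary using (¬_)
open import Data.Empty using (⊥)

-- A permutation group on the finite set V = Fin n is given by the (finite)
-- list of its elements; permutations are identified extensionally.
Perm : ℕ → Set
Perm n = Permutation′ n

_≗ₚ_ : ∀ {n} → Perm n → Perm n → Set
σ ≗ₚ τ = ∀ x → σ ⟨$⟩ʳ x ≡ τ ⟨$⟩ʳ x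

_∈G_ : ∀ {n} → Perm n → List (Perm n) → Set
σ ∈G G = Any (λ τ → τ ≗ₚ σ) G

record IsPermGroup {n} (G : List (Perm n)) : Set where
  field
    has-id  : Σ (Perm n) λ ρ → ρ ∈G G × (∀ x → ρ ⟨$⟩ʳ x ≡ x)
    has-∘   : ∀ σ τ → σ ∈G G → τ ∈G G →
              Σ (Perm n) λ ρ → ρ ∈G G × (∀ x → ρ ⟨$⟩ʳ x ≡ σ ⟨$⟩ʳ (τ ⟨$⟩ʳ x))
    has-inv : ∀ σ → σ ∈G G →
              Σ (Perm n) λ ρ → ρ ∈G G × (∀ x → ρ ⟨$⟩ʳ x ≡ σ ⟨$⟩ˡ x)

Subset : ℕ → Set₁
Subset n = Fin n → Set

_∈Stab_at_ : ∀ {n} → Perm n → List (Perm n) → Fin n → Set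
σ ∈Stab G at v = σ ∈G G × σ ⟨$⟩ʳ v ≡ v

StabOrbit : ∀ {n} → List (Perm n) → Fin n → Fin n → Subset n
StabOrbit {n} G v x y = Σ (Perm n) λ σ → σ ∈Stab G at v × σ ⟨$⟩ʳ x ≡ y

-- Vertices of the bipartite graph B(v',v''): an orbit of 𝔊_{v'} (tag false)
-- or of 𝔊_{v''} (tag true), each represented by one of its points.
Vertex : ℕ → Set
Vertex n = Bool × Fin n

orbitOf : ∀ {n} → List (Perm n) → Fin n → Fin n → Vertex n → Subset n
orbitOf G v' v'' (false , x) = StabOrbit G v' x
orbitOf G v' v'' (true  , x) = StabOrbit G v'' x

Adj : ∀ {n} → List (Perm n) → Fin n → Fin n → Vertex n → Vertex n → Set
Adj G v' v'' (false , x) (true , y) = ∃ λ z → StabOrbit G v' x z × StabOrbit G v'' y z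
Adj G v' v'' (true , y) (false , x) = ∃ λ z → StabOrbit G v' x z × StabOrbit G v'' y z
Adj G v' v'' (false , _) (false , _) = ⊥
Adj G v' v'' (true , _) (true , _) = ⊥

Connected : ∀ {n} → List (Perm n) → Fin n → Fin n → Vertex n → Vertex n → Set
Connected G v' v'' = Star (Adj G v' v'')

C[_] : ∀ {n} → Fin n → List (Perm n) → Fin n → Subset n
C[ v' ] G v'' z = Σ (Vertex _) λ w → Connected G v' v'' (false , v') w × orbitOf G v' v'' w z

image : ∀ {n} → Perm n → Subset n → Subset n
image σ B z = ∃ λ b → B b × σ ⟨$⟩ʳ b ≡ z

SameSet : ∀ {n} → Subset n → Subset n → Set
SameSet A B = ∀ z → (A z → B z) × (B z → A z)

Disjoint : ∀ {n} → Subset n → Subset n → Set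
Disjoint A B = ∀ z → ¬ (A z × B z)

IsBlock : ∀ {n} → List (Perm n) → Subset n → Set
IsBlock {n} G B =
  (∃ λ b → B b) ×
  (∃ λ w → ∀ z → B z → Σ (Perm n) λ σ → σ ∈G G × σ ⟨$⟩ʳ w ≡ z) ×
  (∀ σ → σ ∈G G → SameSet (image σ B) B ⊎ Disjoint (image σ B) B)

-- Let H = ⟨𝔊_{v'}, 𝔊_{v''}⟩. The component of B(v',v'') through the 𝔊_{v'}-orbit of v' covers
-- exactly the points reachable from v' by applying elements of 𝔊_{v'} or 𝔊_{v''}, i.e. the orbit Hv'.
-- If σ ∈ 𝔊 sends a point a = ρ₁v' of Hv' to a point σa = ρ₂⁻¹v' of Hv' (ρ₁, ρ₂ ∈ H), then ρ₂σρ₁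
-- fixes v', so σ = ρ₂⁻¹(ρ₂σρ₁)ρ₁⁻¹ ∈ H and σ(Hv') = Hv'; otherwise σ(Hv') ∩ Hv' = ∅.
-- Since V is finite, reachability is decidable, which makes this dichotomy constructive.
module Submission where

open import Defs
open import Level using (Level; 0ℓ)
open import Data.Nat using (ℕ; zero; suc; _≤_; _<_; _+_)
open import Data.Nat.Properties using (≤-trans; ≤-reflexive; ≤-<-trans; <⇒≱; +-suc; +-identityʳ; +-monoˡ-≤; m≤n+m)
open import Data.Fin using (Fin; _≟_)
open import Data.Fin.Properties using (any?)
open import Data.Fin.Subset using (_∈_; _∉_; _∪_; ⁅_⁆; ∣_∣) renaming (Subset to FinSubset)
open import Data.Fin.Subset.Properties using (_∈?_; x∈⁅x⁆; x∈⁅y⁆⇒x≡y; x∈p∪q⁻; p⊆p∪q; q⊆p∪q; p⊂q⇒∣p∣<∣q∣; ∣p∣≤n)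
open import Data.Fin.Permutation using (_⟨$⟩ʳ_; _⟨$⟩ˡ_; inverseˡ; inverseʳ)
open import Data.List using (List)
open import Data.List.Relation.Unary.Any as Any using (Any)
open import Data.List.Membership.Propositional using (find)
open import Data.Product using (Σ; ∃; ∃₂; _×_; _,_; proj₂)
open import Data.Sum using (_⊎_; inj₁; inj₂)
open import Data.Bool using (false; true)
open import Relation.Nullary using (Dec; yes; no; contradiction)
open import Relation.Nullary.Decidable using (_×-dec_; ¬?; map′)
open import Relation.Unary using (Pred) renaming (Decidable to DecidablePred)
open import Relation.Binary using (Rel; Decidable; Sym)
open import Relation.Binary.PropositionalEquality using (_≡_; refl; sym; trans; cong; subst)
open import Relation.Binary.Construct.Closure.ReflexiveTransitive using (Star; ε; _◅_; _◅◅_; reverse)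

module _ {n : ℕ} {ℓ : Level} {R : Rel (Fin n) ℓ} (R? : Decidable R) (x : Fin n) where

  ReachableFrom : FinSubset n → Set ℓ
  ReachableFrom T = ∀ {y} → y ∈ T → Star R x y

  Closed : FinSubset n → Set ℓ
  Closed T = ∀ {y z} → y ∈ T → R y z → z ∈ T

  closed⇒Star⊆ : ∀ {T} → Closed T → ∀ {y z} → y ∈ T → Star R y z → z ∈ T
  closed⇒Star⊆ closed y∈T ε = y∈T
  closed⇒Star⊆ closed y∈T (r ◅ rs) = closed⇒Star⊆ closed (closed y∈T r) rs

  exit? : ∀ T → Dec (∃₂ λ y z → y ∈ T × R y z × z ∉ T)
  exit? T = any? λ y → any? λ z → (y ∈? T) ×-dec R? y z ×-dec ¬? (z ∈? T)

  Saturation : Set ℓ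
  Saturation = Σ (FinSubset n) λ T → ReachableFrom T × Closed T × x ∈ T

  -- Each round adds an exit point to T, so the fuel k only has to cover the n ∸ ∣ T ∣ missing points.
  saturate : ∀ k T → x ∈ T → ReachableFrom T → n ≤ ∣ T ∣ + k → Saturation
  saturate k T x∈T reach bound with exit? T
  ... | no noExit = T , reach , closed , x∈T
    where
      closed : Closed T
      closed {y} {z} y∈T r with z ∈? T
      ... | yes z∈T = z∈T
      ... | no z∉T = contradiction (y , z , y∈T , r , z∉T) noExit
  ... | yes (y , z , y∈T , r , z∉T) = grow k bound
    where
      T′ : FinSubset n
      T′ = T ∪ ⁅ z ⁆

      ∣T∣<∣T′∣ : ∣ T ∣ < ∣ T′ ∣
      ∣T∣<∣T′∣ = p⊂q⇒∣p∣<∣q∣ (p⊆p∪q ⁅ z ⁆ , z , q⊆p∪q T ⁅ z ⁆ (x∈⁅x⁆ z) , z∉T)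

      reach′ : ReachableFrom T′
      reach′ w∈T′ with x∈p∪q⁻ T ⁅ z ⁆ w∈T′
      ... | inj₁ w∈T = reach w∈T
      ... | inj₂ w∈⁅z⁆ rewrite x∈⁅y⁆⇒x≡y z w∈⁅z⁆ = reach y∈T ◅◅ (r ◅ ε)

      grow : ∀ k → n ≤ ∣ T ∣ + k → Saturation
      grow zero bound =
        contradiction (∣p∣≤n T′) (<⇒≱ (≤-<-trans (subst (n ≤_) (+-identityʳ _) bound) ∣T∣<∣T′∣))
      grow (suc k) bound = saturate k T′ (p⊆p∪q ⁅ z ⁆ x∈T) reach′
        (≤-trans bound (≤-trans (≤-reflexive (+-suc ∣ T ∣ k)) (+-monoˡ-≤ k ∣T∣<∣T′∣)))

  Star? : ∀ y → Dec (Star R x y)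
  Star? y with saturate n ⁅ x ⁆ (x∈⁅x⁆ x) reach₀ (m≤n+m n _)
    where
      reach₀ : ReachableFrom ⁅ x ⁆
      reach₀ y∈⁅x⁆ rewrite x∈⁅y⁆⇒x≡y x y∈⁅x⁆ = ε
  ... | T , reach , closed , x∈T = map′ reach (closed⇒Star⊆ closed x∈T) (y ∈? T)

module _ {n : ℕ} (G : List (Perm n)) where

  ∃∈G? : {P : Pred (Perm n) 0ℓ} → (∀ {σ τ} → τ ≗ₚ σ → P σ → P τ) → DecidablePred P →
         Dec (∃ λ σ → σ ∈G G × P σ)
  ∃∈G? resp P? with Any.any? P? G
  ... | yes any = let σ , σ∈G , p = find any in yes (σ , Any.map (λ { refl _ → refl }) σ∈G , p)
  ... | no none = no λ (σ , σ∈G , p) → none (Any.map (λ τ≗σ → resp τ≗σ p) σ∈G)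

  StabOrbit? : ∀ v x y → Dec (StabOrbit G v x y)
  StabOrbit? v x y =
    map′ (λ (σ , σ∈G , σv , σx) → σ , (σ∈G , σv) , σx) (λ (σ , (σ∈G , σv) , σx) → σ , σ∈G , σv , σx)
         (∃∈G? (λ τ≗σ (σv , σx) → trans (τ≗σ v) σv , trans (τ≗σ x) σx)
               (λ σ → (σ ⟨$⟩ʳ v ≟ v) ×-dec (σ ⟨$⟩ʳ x ≟ y)))

module _ {n : ℕ} {G : List (Perm n)} (isG : IsPermGroup G) where
  open IsPermGroup isG

  stabOrbit-refl : ∀ v x → StabOrbit G v x x
  stabOrbit-refl v x with has-id
  ... | ρ , ρ∈G , ρ≗id = ρ , (ρ∈G , ρ≗id v) , ρ≗id x

  stabOrbit-trans : ∀ v {x y z} → StabOrbit G v x y → StabOrbit G v y z → StabOrbit G v x z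
  stabOrbit-trans v {x} (σ , (σ∈G , σv) , σx) (τ , (τ∈G , τv) , τy) with has-∘ τ σ τ∈G σ∈G
  ... | ρ , ρ∈G , ρ≗τσ = ρ , (ρ∈G , trans (ρ≗τσ v) (trans (cong (τ ⟨$⟩ʳ_) σv) τv)) ,
                           trans (ρ≗τσ x) (trans (cong (τ ⟨$⟩ʳ_) σx) τy)

  stabOrbit-sym : ∀ v {x y} → StabOrbit G v x y → StabOrbit G v y x
  stabOrbit-sym v {x} {y} (σ , (σ∈G , σv) , σx) with has-inv σ σ∈G
  ... | ρ , ρ∈G , ρ≗σ⁻¹ =
    ρ , (ρ∈G , trans (ρ≗σ⁻¹ v) (inverse-at σv)) , trans (ρ≗σ⁻¹ y) (inverse-at σx)
    where
      inverse-at : ∀ {a b} → σ ⟨$⟩ʳ a ≡ b → σ ⟨$⟩ˡ b ≡ a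
      inverse-at refl = inverseˡ σ

  module _ (v' v'' : Fin n) where

    Step : Rel (Fin n) 0ℓ
    Step x y = StabOrbit G v' x y ⊎ StabOrbit G v'' x y

    infix 4 _~_
    _~_ : Rel (Fin n) 0ℓ
    _~_ = Star Step

    Step? : Decidable Step
    Step? x y with StabOrbit? G v' x y | StabOrbit? G v'' x y
    ... | yes s | _ = yes (inj₁ s)
    ... | no _ | yes s = yes (inj₂ s)
    ... | no ¬s′ | no ¬s″ = no λ { (inj₁ s) → ¬s′ s ; (inj₂ s) → ¬s″ s }

    step-sym : Sym Step Step
    step-sym (inj₁ s) = inj₁ (stabOrbit-sym v' s)
    step-sym (inj₂ s) = inj₂ (stabOrbit-sym v'' s)

    ~-sym : Sym _~_ _~_
    ~-sym = reverse step-sym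

    ~-reflexive : ∀ {x y} → x ≡ y → x ~ y
    ~-reflexive refl = ε

    C⇒~ : ∀ {z} → C[ v' ] G v'' z → v' ~ z
    C⇒~ {z} (w , path , z∈w) = connected⇒~ path ◅◅ orbit⇒step w z∈w ◅ ε
      where
        orbit⇒step : ∀ w → orbitOf G v' v'' w z → Step (proj₂ w) z
        orbit⇒step (false , _) = inj₁
        orbit⇒step (true , _) = inj₂

        adj⇒~ : ∀ {b x c y} → Adj G v' v'' (b , x) (c , y) → x ~ y
        adj⇒~ {false} {_} {true} (_ , o′ , o″) = inj₁ o′ ◅ inj₂ (stabOrbit-sym v'' o″) ◅ ε
        adj⇒~ {true} {_} {false} (_ , o′ , o″) = inj₂ o″ ◅ inj₁ (stabOrbit-sym v' o′) ◅ ε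

        connected⇒~ : ∀ {b x c y} → Connected G v' v'' (b , x) (c , y) → x ~ y
        connected⇒~ ε = ε
        connected⇒~ (a ◅ as) = adj⇒~ a ◅◅ connected⇒~ as

    C-v' : C[ v' ] G v'' v'
    C-v' = (false , v') , ε , stabOrbit-refl v' v'

    -- Stepping out of an orbit on one side enters the adjacent orbit on the other side.
    C-step : ∀ {x y} → C[ v' ] G v'' x → Step x y → C[ v' ] G v'' y
    C-step ((false , r) , path , x∈O) (inj₁ s) = (false , r) , path , stabOrbit-trans v' x∈O s
    C-step ((true , r) , path , x∈O) (inj₂ s) = (true , r) , path , stabOrbit-trans v'' x∈O s
    C-step {x} ((true , r) , path , x∈O) (inj₁ s) =
      (false , x) , path ◅◅ (x , stabOrbit-refl v' x , x∈O) ◅ ε , s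
    C-step {x} ((false , r) , path , x∈O) (inj₂ s) =
      (true , x) , path ◅◅ (x , x∈O , stabOrbit-refl v'' x) ◅ ε , s

    ~⇒C : ∀ {z} → v' ~ z → C[ v' ] G v'' z
    ~⇒C = go C-v'
      where
        go : ∀ {x z} → C[ v' ] G v'' x → x ~ z → C[ v' ] G v'' z
        go c ε = c
        go c (s ◅ ss) = go (C-step c s) ss

    -- The property of the elements of ⟨𝔊_{v'}, 𝔊_{v''}⟩ that the argument needs.
    InJoin : Perm n → Set
    InJoin ρ = ∀ z → z ~ ρ ⟨$⟩ʳ z

    JoinElement : Fin n → Fin n → Set
    JoinElement x y = Σ (Perm n) λ ρ → ρ ∈G G × ρ ⟨$⟩ʳ x ≡ y × InJoin ρ

    step⇒joinElement : ∀ {x y} → Step x y → JoinElement x y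
    step⇒joinElement (inj₁ (τ , τ∈Stab@(τ∈G , _) , τx)) = τ , τ∈G , τx , λ _ → inj₁ (τ , τ∈Stab , refl) ◅ ε
    step⇒joinElement (inj₂ (τ , τ∈Stab@(τ∈G , _) , τx)) = τ , τ∈G , τx , λ _ → inj₂ (τ , τ∈Stab , refl) ◅ ε

    ~⇒joinElement : ∀ {x y} → x ~ y → JoinElement x y
    ~⇒joinElement ε with has-id
    ... | ρ , ρ∈G , ρ≗id = ρ , ρ∈G , ρ≗id _ , λ z → ~-reflexive (sym (ρ≗id z))
    ~⇒joinElement {x} (s ◅ ss) with step⇒joinElement s | ~⇒joinElement ss
    ... | τ , τ∈G , τx , τ-join | σ , σ∈G , σy , σ-join with has-∘ σ τ σ∈G τ∈G
    ... | ρ , ρ∈G , ρ≗στ =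
      ρ , ρ∈G , trans (ρ≗στ x) (trans (cong (σ ⟨$⟩ʳ_) τx) σy) ,
      λ z → τ-join z ◅◅ σ-join (τ ⟨$⟩ʳ z) ◅◅ ~-reflexive (sym (ρ≗στ z))

    -- With a = ρ₁ v' and ρ₂ (π a) = v', the element ρ₂ π ρ₁ is a single 𝔊_{v'}-step.
    meets-C⇒inJoin : ∀ π a → π ∈G G → v' ~ a → v' ~ π ⟨$⟩ʳ a → InJoin π
    meets-C⇒inJoin π a π∈G v'~a v'~πa c with ~⇒joinElement v'~a | ~⇒joinElement (~-sym v'~πa)
    ... | ρ₁ , ρ₁∈G , ρ₁v' , ρ₁-join | ρ₂ , ρ₂∈G , ρ₂πa , ρ₂-join with has-∘ π ρ₁ π∈G ρ₁∈G
    ... | πρ₁ , πρ₁∈G , πρ₁≗ with has-∘ ρ₂ πρ₁ ρ₂∈G πρ₁∈G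
    ... | g , g∈G , g≗ = c~c′ ◅◅ inj₁ (g , (g∈G , gv') , refl) ◅ gc′~πc
      where
        c′ : Fin n
        c′ = ρ₁ ⟨$⟩ˡ c

        g-at : ∀ x → g ⟨$⟩ʳ x ≡ ρ₂ ⟨$⟩ʳ (π ⟨$⟩ʳ (ρ₁ ⟨$⟩ʳ x))
        g-at x = trans (g≗ x) (cong (ρ₂ ⟨$⟩ʳ_) (πρ₁≗ x))

        gv' : g ⟨$⟩ʳ v' ≡ v'
        gv' = trans (g-at v') (trans (cong (λ y → ρ₂ ⟨$⟩ʳ (π ⟨$⟩ʳ y)) ρ₁v') ρ₂πa)

        c~c′ : c ~ c′
        c~c′ = ~-sym (subst (c′ ~_) (inverseʳ ρ₁) (ρ₁-join c′))

        gc′~πc : g ⟨$⟩ʳ c′ ~ π ⟨$⟩ʳ c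
        gc′~πc = subst (λ y → y ~ π ⟨$⟩ʳ c)
                       (sym (trans (g-at c′) (cong (λ y → ρ₂ ⟨$⟩ʳ (π ⟨$⟩ʳ y)) (inverseʳ ρ₁))))
                       (~-sym (ρ₂-join (π ⟨$⟩ʳ c)))

    C-block-dichotomy : ∀ σ → σ ∈G G →
      SameSet (image σ (C[ v' ] G v'')) (C[ v' ] G v'') ⊎ Disjoint (image σ (C[ v' ] G v'')) (C[ v' ] G v'')
    C-block-dichotomy σ σ∈G with Star? Step? v' (σ ⟨$⟩ʳ v')
    ... | yes v'~σv' = inj₁ λ _ → σC⊆C , C⊆σC
      where
        σ-join : InJoin σ
        σ-join = meets-C⇒inJoin σ v' σ∈G ε v'~σv'

        σC⊆C : ∀ {z} → image σ (C[ v' ] G v'') z → C[ v' ] G v'' z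
        σC⊆C (b , b∈C , refl) = ~⇒C (C⇒~ b∈C ◅◅ σ-join b)

        C⊆σC : ∀ {z} → C[ v' ] G v'' z → image σ (C[ v' ] G v'') z
        C⊆σC {z} z∈C = σ ⟨$⟩ˡ z ,
          ~⇒C (C⇒~ z∈C ◅◅ ~-sym (subst (σ ⟨$⟩ˡ z ~_) (inverseʳ σ) (σ-join (σ ⟨$⟩ˡ z)))) ,
          inverseʳ σ
    ... | no ¬v'~σv' = inj₂ λ { _ ((b , b∈C , refl) , σb∈C) →
      ¬v'~σv' (meets-C⇒inJoin σ b σ∈G (C⇒~ b∈C) (C⇒~ σb∈C) v') }

lemma2p6 : (n : ℕ) (G : List (Perm n)) → IsPermGroup G →
    (v' v'' : Fin n) → IsBlock G (C[ v' ] G v'')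
lemma2p6 n G isG v' v'' =
  (v' , C-v' isG v' v'') ,
  (v' , λ _ z∈C → let σ , σ∈G , σv' , _ = ~⇒joinElement isG v' v'' (C⇒~ isG v' v'' z∈C) in σ , σ∈G , σv') ,
  C-block-dichotomy isG v' v''
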